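{- Let $S=\mathcal{P}_S\cup\mathcal{L}_S$ be a resolving set for a biaffine plane $B_q$ of order $q$ ($\mathcal{P}_S$ points, $\mathcal{L}_S$ lines), and let $u$ be the number of uncovered directions. Then the number $\delta$ of lines of $B_q$ skew to $\mathcal{P}_S$ is at most $|\mathcal{L}_S|+q$; moreover, $\delta\leq |\mathcal{L}_S|+q-u+1$.
   Context: A biaffine plane of order $q$ is obtained from an affine plane of order $q$ by deleting all lines of one parallel class (keeping all points); its directions are the $q$ remaining parallel classes of lines. A resolving set is a vertex set $S$ of its incidence graph (bipartite graph on points and lines, adjacency = incidence) such that every two distinct vertices $u\neq v$ have some $x\in S$ with $d(u,x)\neq d(v,x)$. A line is skew to $\mathcal{P}_S$ if it contains no point of $\mathcal{P}_S$. A direction is uncovered if $\mathcal{L}_S$ contains no line of that parallel class. -}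

module Defs where

open import Data.Nat using (ℕ; zero; suc; _+_; _≤_; _<_; _<?_)
open import Data.Fin using (Fin; zero; suc; toℕ)
open import Data.Fin.Properties using () renaming (_≟_ to _≟ᶠ_)
open import Data.Bool using (Bool; true; false; _∧_; _∨_; not; if_then_else_)
open import Data.Unit using (⊤)
open import Data.Empty using (⊥)
open import Data.Sum using (_⊎_; inj₁; inj₂)
open import Data.Product using (Σ; ∃; _×_; _,_)
open import Relation.Nullary using (¬_; does)
open import Relation.Binary.PropositionalEquality using (_≡_; _≢_)

countF : (n : ℕ) → (Fin n → Bool) → ℕ
countF zero    f = 0
countF (suc n) f = (if f zero then 1 else 0) + countF n (λ i → f (suc i))

anyF : (n : ℕ) → (Fin n → Bool) → Bool
anyF zero    f = false
anyF (suc n) f = f zero ∨ anyF n (λ i → f (suc i))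

module Incidence {np nl : ℕ} (inc : Fin np → Fin nl → Bool) where

  I : Fin np → Fin nl → Set
  I p l = inc p l ≡ true

  meet : Fin nl → Fin nl → Bool
  meet l m = anyF np (λ p → inc p l ∧ inc p m)

  par : Fin nl → Fin nl → Bool
  par l m = does (l ≟ᶠ m) ∨ not (meet l m)

  Par : Fin nl → Fin nl → Set
  Par l m = par l m ≡ true

  pointsOn : Fin nl → ℕ
  pointsOn l = countF np (λ p → inc p l)

  record IsAffinePlane (q : ℕ) : Set where
    field
      joinLine : ∀ (p r : Fin np) → p ≢ r →
        Σ (Fin nl) λ l → (I p l × I r l) ×
          (∀ (m : Fin nl) → I p m → I r m → m ≡ l)
      parallelLine : ∀ (p : Fin np) (l : Fin nl) →
        Σ (Fin nl) λ m → (I p m × Par m l) ×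
          (∀ (m' : Fin nl) → I p m' → Par m' l → m' ≡ m)
      nonCollinear : Σ (Fin np) λ a → Σ (Fin np) λ b → Σ (Fin np) λ c →
        a ≢ b × a ≢ c × b ≢ c ×
        (∀ (l : Fin nl) → ¬ (I a l × I b l × I c l))
      order : Σ (Fin nl) λ l → pointsOn l ≡ q

  -- The biaffine plane obtained by deleting the parallel class of line l₀.
  module Biaffine (l₀ : Fin nl) where

    inB : Fin nl → Bool
    inB l = not (par l l₀)

    InB : Fin nl → Set
    InB l = inB l ≡ true

    Vtx : Set
    Vtx = Fin np ⊎ Fin nl

    IsVertex : Vtx → Set
    IsVertex (inj₁ p) = ⊤
    IsVertex (inj₂ l) = InB l

    Adj : Vtx → Vtx → Set
    Adj (inj₁ p) (inj₁ r) = ⊥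
    Adj (inj₁ p) (inj₂ l) = I p l × InB l
    Adj (inj₂ l) (inj₁ p) = I p l × InB l
    Adj (inj₂ l) (inj₂ m) = ⊥

    data Walk : Vtx → Vtx → ℕ → Set where
      here : ∀ {u} → Walk u u 0
      step : ∀ {u v w n} → Adj u v → Walk v w n → Walk u w (suc n)

    Dist : Vtx → Vtx → ℕ → Set
    Dist u v n = Walk u v n × (∀ m → Walk u v m → n ≤ m)

    InS : (Fin np → Bool) → (Fin nl → Bool) → Vtx → Set
    InS PS LS (inj₁ p) = PS p ≡ true
    InS PS LS (inj₂ l) = LS l ≡ true

    Resolving : (Fin np → Bool) → (Fin nl → Bool) → Set
    Resolving PS LS =
      (∀ l → LS l ≡ true → InB l) ×
      (∀ (u v : Vtx) → IsVertex u → IsVertex v → u ≢ v →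
        Σ Vtx λ x → InS PS LS x ×
          Σ ℕ λ a → Σ ℕ λ b → Dist u x a × Dist v x b × a ≢ b)

    skewCount : (Fin np → Bool) → ℕ
    skewCount PS = countF nl (λ l → inB l ∧ not (anyF np (λ p → PS p ∧ inc p l)))

    card : (Fin nl → Bool) → ℕ
    card LS = countF nl LS

    minRep : Fin nl → Bool
    minRep l = not (anyF nl (λ m → does (toℕ m <? toℕ l) ∧ par m l))

    -- number of uncovered directions: parallel classes of B (counted via their
    -- least-indexed representative) containing no line of L_S
    uncovered : (Fin nl → Bool) → ℕ
    uncovered LS = countF nl (λ l → inB l ∧ minRep l ∧ not (anyF nl (λ m → LS m ∧ par m l)))

-- Let T be the set of lines of the biaffine plane that are skew to P_S and not in L_S.
-- Two distinct parallel lines of T are equidistant from every vertex of S, since a walk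
-- from one of them to S can be rerouted to start at the other; so are two non-parallel
-- lines of T with uncovered directions, since every vertex of S is then at distance 2
-- or 3 from both. As S is resolving, T is pairwise non-parallel, so |T| ≤ q, and at most
-- one line of T has an uncovered direction. The lines of T with covered direction
-- together with one line per uncovered direction are again pairwise non-parallel, hence
-- at most q. As δ ≤ |L_S| + |T|, both bounds follow.
module Submission where

open import Defs
open import Data.Nat using (ℕ; zero; suc; _+_; _≤_; _<?_; z≤n; s≤s)
open import Data.Nat.Properties
  using (≤-trans; ≤-refl; n≤1+n; ≤-antisym; ≮⇒≥; +-suc; +-comm; +-assoc; +-mono-≤; +-monoˡ-≤; +-monoʳ-≤;
         module ≤-Reasoning)
open import Data.Fin using (Fin; zero; suc; toℕ)
open import Data.Fin.Properties using (suc-injective; 0≢1+n; toℕ-injective) renaming (_≟_ to _≟ᶠ_)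
open import Data.Bool using (Bool; true; false; _∧_; _∨_; not; if_then_else_)
open import Data.Bool.Properties using (∧-comm; ∧-identityʳ; ∨-zeroʳ; ∧-conicalˡ; ∧-conicalʳ)
open import Data.Empty using (⊥; ⊥-elim)
open import Data.Unit using (⊤; tt)
open import Data.Sum using (_⊎_; inj₁; inj₂)
open import Data.Product using (Σ; _×_; _,_; proj₁; proj₂)
open import Relation.Nullary using (¬_; Dec; yes; no; does)
open import Relation.Nullary.Decidable using (decidable-stable)
open import Relation.Binary.PropositionalEquality
open import Function using (_∘_)

∧-intro : ∀ {a b} → a ≡ true → b ≡ true → a ∧ b ≡ true
∧-intro refl refl = refl

∨-introˡ : ∀ {a} b → a ≡ true → a ∨ b ≡ true
∨-introˡ b refl = refl

∨-introʳ : ∀ a {b} → b ≡ true → a ∨ b ≡ true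
∨-introʳ true  _  = refl
∨-introʳ false eq = eq

∨-true⁻ : ∀ a b → a ∨ b ≡ true → a ≡ true ⊎ b ≡ true
∨-true⁻ true  b _  = inj₁ refl
∨-true⁻ false b eq = inj₂ eq

not-true : ∀ {a} → a ≢ true → not a ≡ true
not-true {false} _      = refl
not-true {true}  a≢true = ⊥-elim (a≢true refl)

not-true⁻ : ∀ {a} → not a ≡ true → a ≢ true
not-true⁻ {false} _ ()

does-true : ∀ {A : Set} (a? : Dec A) → A → does a? ≡ true
does-true (yes _) _ = refl
does-true (no ¬a) a = ⊥-elim (¬a a)

does-true⁻ : ∀ {A : Set} (a? : Dec A) → does a? ≡ true → A
does-true⁻ (yes a) _ = a

anyF-witness : ∀ n (f : Fin n → Bool) → anyF n f ≡ true → Σ (Fin n) λ i → f i ≡ true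
anyF-witness (suc n) f eq with f zero in f0
... | true  = zero , f0
... | false with anyF-witness n (λ i → f (suc i)) eq
...   | i , fi = suc i , fi

anyF-intro : ∀ n (f : Fin n → Bool) i → f i ≡ true → anyF n f ≡ true
anyF-intro (suc n) f zero    fi rewrite fi = refl
anyF-intro (suc n) f (suc i) fi = ∨-introʳ (f zero) (anyF-intro n (λ j → f (suc j)) i fi)

anyF-cong : ∀ n {f g : Fin n → Bool} → (∀ i → f i ≡ g i) → anyF n f ≡ anyF n g
anyF-cong zero    f≗g = refl
anyF-cong (suc n) f≗g = cong₂ _∨_ (f≗g zero) (anyF-cong n (λ i → f≗g (suc i)))

indicator : Bool → ℕ
indicator b = if b then 1 else 0

countF-cong : ∀ n {f g : Fin n → Bool} → (∀ i → f i ≡ g i) → countF n f ≡ countF n g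
countF-cong zero    f≗g = refl
countF-cong (suc n) f≗g = cong₂ _+_ (cong indicator (f≗g zero)) (countF-cong n (λ i → f≗g (suc i)))

countF-split : ∀ n (f g : Fin n → Bool) →
  countF n f ≡ countF n (λ i → f i ∧ g i) + countF n (λ i → f i ∧ not (g i))
countF-split zero    f g = refl
countF-split (suc n) f g = step (f zero) (g zero) (countF-split n (λ i → f (suc i)) (λ i → g (suc i)))
  where
  step : ∀ a b {X A B} → X ≡ A + B →
    indicator a + X ≡ (indicator (a ∧ b) + A) + (indicator (a ∧ not b) + B)
  step true  true        eq = cong suc eq
  step true  false {A = A} {B} eq = trans (cong suc eq) (sym (+-suc A B))
  step false _           eq = eq

countF-mono : ∀ n {f g : Fin n → Bool} → (∀ i → f i ≡ true → g i ≡ true) → countF n f ≤ countF n g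
countF-mono zero    f⇒g = z≤n
countF-mono (suc n) {f} {g} f⇒g = step (f zero) (g zero) (f⇒g zero) (countF-mono n (λ i → f⇒g (suc i)))
  where
  step : ∀ a b {X Y} → (a ≡ true → b ≡ true) → X ≤ Y → indicator a + X ≤ indicator b + Y
  step true  true  _   X≤Y = s≤s X≤Y
  step true  false a⇒b _   with () ← a⇒b refl
  step false true  _   X≤Y = ≤-trans X≤Y (n≤1+n _)
  step false false _   X≤Y = X≤Y

countF-remove : ∀ n (g : Fin n → Bool) j → g j ≡ true →
  countF n g ≡ suc (countF n (λ i → g i ∧ not (does (i ≟ᶠ j))))
countF-remove (suc n) g zero gj rewrite gj =
  cong suc (countF-cong n (λ i → sym (∧-identityʳ (g (suc i)))))
countF-remove (suc n) g (suc j) gj with g zero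
... | true  = cong suc (countF-remove n (λ i → g (suc i)) j gj)
... | false = countF-remove n (λ i → g (suc i)) j gj

countF-≤-injection : ∀ n k (f : Fin n → Bool) (g : Fin k → Bool) (R : Fin n → Fin k → Set) →
  (∀ i → f i ≡ true → Σ (Fin k) λ j → g j ≡ true × R i j) →
  (∀ i i' j → f i ≡ true → f i' ≡ true → R i j → R i' j → i ≡ i') →
  countF n f ≤ countF k g
countF-≤-injection zero    k f g R total injective = z≤n
countF-≤-injection (suc n) k f g R total injective with f zero in f0
... | false = countF-≤-injection n k (f ∘ suc) g (R ∘ suc) (total ∘ suc) injective-suc
  where
  injective-suc : ∀ i i' j → f (suc i) ≡ true → f (suc i') ≡ true → R (suc i) j → R (suc i') j → i ≡ i'
  injective-suc i i' j fi fi' r r' = suc-injective (injective _ _ j fi fi' r r')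
... | true with total zero f0
...   | j₀ , gj₀ , r₀ = begin
  suc (countF n (f ∘ suc)) ≤⟨ s≤s (countF-≤-injection n k (f ∘ suc) others (R ∘ suc) total-others injective-suc) ⟩
  suc (countF k others)    ≡⟨ countF-remove k g j₀ gj₀ ⟨
  countF k g               ∎
  where
  open ≤-Reasoning

  others : Fin k → Bool
  others j = g j ∧ not (does (j ≟ᶠ j₀))

  injective-suc : ∀ i i' j → f (suc i) ≡ true → f (suc i') ≡ true → R (suc i) j → R (suc i') j → i ≡ i'
  injective-suc i i' j fi fi' r r' = suc-injective (injective _ _ j fi fi' r r')

  total-others : ∀ i → f (suc i) ≡ true → Σ (Fin k) λ j → others j ≡ true × R (suc i) j
  total-others i fi with total (suc i) fi
  ... | j , gj , r = j , ∧-intro gj (not-true λ j≡j₀ → 0≢1+n (sym (injective (suc i) zero j₀ fi f0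
                                       (subst (R (suc i)) (does-true⁻ (j ≟ᶠ j₀) j≡j₀) r) r₀))) , r

countF-≤1 : ∀ n (f : Fin n → Bool) → (∀ i j → f i ≡ true → f j ≡ true → i ≡ j) → countF n f ≤ 1
countF-≤1 n f unique = countF-≤-injection n 1 f (λ _ → true) (λ _ _ → ⊤)
  (λ _ _ → zero , refl , tt) (λ i i' _ fi fi' _ _ → unique i i' fi fi')

-- Parallelism in an affine plane

module AffinePlane {np nl : ℕ} {inc : Fin np → Fin nl → Bool} {q : ℕ}
                   (plane : Incidence.IsAffinePlane inc q) where
  open Incidence inc
  open IsAffinePlane plane

  meet-intro : ∀ {p a b} → I p a → I p b → meet a b ≡ true
  meet-intro {p} {a} {b} pa pb = anyF-intro np (λ r → inc r a ∧ inc r b) p (∧-intro pa pb)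

  meet-witness : ∀ {a b} → meet a b ≡ true → Σ (Fin np) λ p → I p a × I p b
  meet-witness {a} {b} eq with anyF-witness np (λ r → inc r a ∧ inc r b) eq
  ... | p , pab = p , ∧-conicalˡ _ _ pab , ∧-conicalʳ _ _ pab

  meet-sym : ∀ a b → meet a b ≡ meet b a
  meet-sym a b = anyF-cong np (λ p → ∧-comm (inc p a) (inc p b))

  par-refl : ∀ {a} → Par a a
  par-refl {a} = cong (_∨ not (meet a a)) (does-true (a ≟ᶠ a) refl)

  disjoint⇒par : ∀ {a b} → meet a b ≡ false → Par a b
  disjoint⇒par {a} {b} eq = trans (cong (λ m → does (a ≟ᶠ b) ∨ not m) eq) (∨-zeroʳ _)

  par⇒≡⊎disjoint : ∀ {a b} → Par a b → a ≡ b ⊎ meet a b ≡ false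
  par⇒≡⊎disjoint {a} {b} a∥b with a ≟ᶠ b | meet a b
  ... | yes a≡b | _     = inj₁ a≡b
  ... | no _    | false = inj₂ refl

  par? : ∀ a b → Par a b ⊎ ¬ Par a b
  par? a b with par a b
  ... | true  = inj₁ refl
  ... | false = inj₂ λ ()

  ¬par⇒meet : ∀ {a b} → ¬ Par a b → Σ (Fin np) λ p → I p a × I p b
  ¬par⇒meet {a} {b} a∦b = go (meet a b) refl
    where
    go : ∀ m → meet a b ≡ m → Σ (Fin np) λ p → I p a × I p b
    go true  eq = meet-witness eq
    go false eq = ⊥-elim (a∦b (disjoint⇒par eq))

  par-meet⇒≡ : ∀ {a b p} → Par a b → I p a → I p b → a ≡ b
  par-meet⇒≡ a∥b pa pb with par⇒≡⊎disjoint a∥b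
  ... | inj₁ a≡b      = a≡b
  ... | inj₂ disjoint with () ← trans (sym (meet-intro pa pb)) disjoint

  par-sym : ∀ {a b} → Par a b → Par b a
  par-sym a∥b with par⇒≡⊎disjoint a∥b
  ... | inj₁ refl     = par-refl
  ... | inj₂ disjoint = disjoint⇒par (trans (meet-sym _ _) disjoint)

  parallelThrough : Fin np → Fin nl → Fin nl
  parallelThrough p l = proj₁ (parallelLine p l)

  parallelThrough-∋ : ∀ p l → I p (parallelThrough p l)
  parallelThrough-∋ p l = proj₁ (proj₁ (proj₂ (parallelLine p l)))

  parallelThrough-∥ : ∀ p l → Par (parallelThrough p l) l
  parallelThrough-∥ p l = proj₂ (proj₁ (proj₂ (parallelLine p l)))

  parallelThrough-unique : ∀ {p l m} → I p m → Par m l → m ≡ parallelThrough p l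
  parallelThrough-unique {p} {l} {m} = proj₂ (proj₂ (parallelLine p l)) m

  par-trans : ∀ {a b c} → Par a b → Par b c → Par a c
  par-trans {a} {b} {c} a∥b b∥c with par? a c
  ... | inj₁ a∥c = a∥c
  ... | inj₂ a∦c with ¬par⇒meet a∦c
  ...   | p , pa , pc = subst (λ x → Par x c)
          (trans (parallelThrough-unique pc (par-sym b∥c)) (sym (parallelThrough-unique pa a∥b))) par-refl

  join-unique : ∀ {p r a b} → p ≢ r → I p a → I r a → I p b → I r b → a ≡ b
  join-unique {p} {r} p≢r pa ra pb rb with joinLine p r p≢r
  ... | _ , _ , unique = trans (unique _ pa ra) (sym (unique _ pb rb))

  transversal-meets-parallel : ∀ {l m k p} → Par l m → I p m → I p k → k ≢ m →
    Σ (Fin np) λ r → I r k × I r l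
  transversal-meets-parallel l∥m pm pk k≢m =
    ¬par⇒meet λ k∥l → k≢m (par-meet⇒≡ (par-trans k∥l l∥m) pk pm)

  point-off : ∀ l → Σ (Fin np) λ p → inc p l ≡ false
  point-off l with nonCollinear
  ... | a , b , c , _ , _ , _ , collinear with inc a l in al | inc b l in bl | inc c l in cl
  ...   | false | _     | _     = a , al
  ...   | true  | false | _     = b , bl
  ...   | true  | true  | false = c , cl
  ...   | true  | true  | true  = ⊥-elim (collinear l (al , bl , cl))

  nonParallel-count≤order : ∀ l₀ (f : Fin nl → Bool) → (∀ l → f l ≡ true → Biaffine.InB l₀ l) →
    (∀ l m → f l ≡ true → f m ≡ true → Par l m → l ≡ m) → countF nl f ≤ q
  nonParallel-count≤order l₀ f f⊆B f-nonParallel =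
    subst (countF nl f ≤_) (proj₂ order) (countF-≤-injection nl np f (λ p → inc p o) Trace trace trace-injective)
    where
    open Biaffine l₀

    o : Fin nl
    o = proj₁ order

    P : Fin np
    P = proj₁ (point-off o)

    e : Fin nl
    e = parallelThrough P l₀

    -- The line through P parallel to l meets o in p, or it is parallel to o and
    -- p is where e meets o (e itself is not a line of the biaffine plane).
    Trace : Fin nl → Fin np → Set
    Trace l p = I p o × (I p (parallelThrough P l) ⊎ (Par (parallelThrough P l) o × I p e))

    e∦o : ∀ {l} → InB l → Par (parallelThrough P l) o → ¬ Par e o
    e∦o {l} Bl h∥o e∥o = not-true⁻ Bl
      (par-trans (par-sym (parallelThrough-∥ P l))
        (par-trans h∥o (par-trans (par-sym e∥o) (parallelThrough-∥ P l₀))))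

    trace : ∀ l → f l ≡ true → Σ (Fin np) λ p → inc p o ≡ true × Trace l p
    trace l fl with par? (parallelThrough P l) o
    ... | inj₂ h∦o = let (p , ph , po) = ¬par⇒meet h∦o in p , po , po , inj₁ ph
    ... | inj₁ h∥o = let (p , pe , po) = ¬par⇒meet (e∦o (f⊆B l fl) h∥o) in p , po , po , inj₂ (h∥o , pe)

    through-e⇒∥l₀ : ∀ {l p} → p ≢ P → I p (parallelThrough P l) → I p e → Par l l₀
    through-e⇒∥l₀ {l} p≢P ph pe = par-trans (par-sym (parallelThrough-∥ P l))
      (subst (λ x → Par x l₀) (sym (join-unique p≢P ph (parallelThrough-∋ P l) pe (parallelThrough-∋ P l₀)))
        (parallelThrough-∥ P l₀))

    trace-injective : ∀ l l' p → f l ≡ true → f l' ≡ true → Trace l p → Trace l' p → l ≡ l'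
    trace-injective l l' p fl fl' (po , t) (_ , t') = f-nonParallel l l' fl fl'
      (par-trans (par-sym (parallelThrough-∥ P l))
        (subst (λ x → Par x l') (sym (same-parallel t t')) (parallelThrough-∥ P l')))
      where
      p≢P : p ≢ P
      p≢P p≡P with () ← trans (sym po) (trans (cong (λ x → inc x o) p≡P) (proj₂ (point-off o)))

      same-parallel : I p (parallelThrough P l) ⊎ (Par (parallelThrough P l) o × I p e) →
                      I p (parallelThrough P l') ⊎ (Par (parallelThrough P l') o × I p e) →
                      parallelThrough P l ≡ parallelThrough P l'
      same-parallel (inj₁ ph) (inj₁ ph') =
        join-unique p≢P ph (parallelThrough-∋ P l) ph' (parallelThrough-∋ P l')
      same-parallel (inj₂ (h∥o , _)) (inj₂ (h'∥o , _)) =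
        trans (parallelThrough-unique (parallelThrough-∋ P l) h∥o)
              (sym (parallelThrough-unique (parallelThrough-∋ P l') h'∥o))
      same-parallel (inj₁ ph) (inj₂ (_ , pe)) = ⊥-elim (not-true⁻ (f⊆B l fl) (through-e⇒∥l₀ p≢P ph pe))
      same-parallel (inj₂ (_ , pe)) (inj₁ ph') = ⊥-elim (not-true⁻ (f⊆B l' fl') (through-e⇒∥l₀ p≢P ph' pe))

  -- Distances in the incidence graph of the biaffine plane

  module _ (l₀ : Fin nl) where
    open Biaffine l₀

    par-InB : ∀ {l m} → Par l m → InB m → InB l
    par-InB l∥m Bm = not-true λ l∥l₀ → not-true⁻ Bm (par-trans (par-sym l∥m) l∥l₀)

    NoFarther : Fin nl → Fin nl → Vtx → Set
    NoFarther l m x = ∀ {n} → Walk (inj₂ m) x n → Σ ℕ λ c → c ≤ n × Walk (inj₂ l) x c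

    OffLine : Fin nl → Vtx → Set
    OffLine m (inj₁ p) = ¬ I p m
    OffLine m (inj₂ k) = k ≢ m

    -- A walk from m to x leaves m at a point p and continues along a line k; unless
    -- k = m, the line k also meets l, so the same walk can start from l instead.
    parallel-noFarther : ∀ {l m} → Par l m → InB l → ∀ {x} → OffLine m x → NoFarther l m x
    parallel-noFarther l∥m Bl m≢m here = ⊥-elim (m≢m refl)
    parallel-noFarther l∥m Bl p∉m (step {v = inj₁ p} (pm , _) here) = ⊥-elim (p∉m pm)
    parallel-noFarther l∥m Bl x∉m (step {v = inj₂ _} () _)
    parallel-noFarther l∥m Bl x∉m (step {v = inj₁ _} _ (step {v = inj₁ _} () _))
    parallel-noFarther {m = m} l∥m Bl x∉m (step {v = inj₁ p} (pm , _) (step {v = inj₂ k} (pk , Bk) rest))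
      with k ≟ᶠ m
    ... | yes refl = let (c , c≤n , walk) = parallel-noFarther l∥m Bl x∉m rest in
                     c , ≤-trans c≤n (≤-trans (n≤1+n _) (n≤1+n _)) , walk
    ... | no k≢m   = let (r , rk , rl) = transversal-meets-parallel l∥m pm pk k≢m in
                     _ , ≤-refl , step {v = inj₁ r} (rl , Bl) (step {v = inj₂ k} (rk , Bk) rest)

    walk-to-point-off≥3 : ∀ {m p n} → ¬ I p m → Walk (inj₂ m) (inj₁ p) n → 3 ≤ n
    walk-to-point-off≥3 p∉m (step {v = inj₁ _} (pm , _) here) = ⊥-elim (p∉m pm)
    walk-to-point-off≥3 p∉m (step {v = inj₁ _} _ (step {v = inj₂ _} _ (step _ _))) = s≤s (s≤s (s≤s z≤n))
    walk-to-point-off≥3 p∉m (step {v = inj₂ _} () _)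
    walk-to-point-off≥3 p∉m (step {v = inj₁ _} _ (step {v = inj₁ _} () _))

    walk-to-other-line≥2 : ∀ {m k n} → k ≢ m → Walk (inj₂ m) (inj₂ k) n → 2 ≤ n
    walk-to-other-line≥2 k≢m here = ⊥-elim (k≢m refl)
    walk-to-other-line≥2 k≢m (step {v = inj₁ _} _ (step _ _)) = s≤s (s≤s z≤n)
    walk-to-other-line≥2 k≢m (step {v = inj₂ _} () _)

    walk₂ : ∀ {l k} → InB l → InB k → ¬ Par k l → Walk (inj₂ l) (inj₂ k) 2
    walk₂ {k = k} Bl Bk k∦l =
      let (r , rk , rl) = ¬par⇒meet k∦l in step {v = inj₁ r} (rl , Bl) (step {v = inj₂ k} (rk , Bk) here)

    walk-snoc : ∀ {u v w n} → Walk u v n → Adj v w → Walk u w (suc n)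
    walk-snoc here         vw = step vw here
    walk-snoc (step uv walk) vw = step uv (walk-snoc walk vw)

    walk₃ : ∀ {l m} → InB l → InB m → ¬ Par l m → ∀ p → Walk (inj₂ l) (inj₁ p) 3
    walk₃ {l} {m} Bl Bm l∦m p = walk-snoc (walk₂ Bl Bh h∦l) (parallelThrough-∋ p m , Bh)
      where
      Bh : InB (parallelThrough p m)
      Bh = par-InB (parallelThrough-∥ p m) Bm

      h∦l : ¬ Par (parallelThrough p m) l
      h∦l h∥l = l∦m (par-trans (par-sym h∥l) (parallelThrough-∥ p m))

    nonParallel-noFarther-point : ∀ {l m} → InB l → InB m → ¬ Par l m →
      ∀ {p} → ¬ I p m → NoFarther l m (inj₁ p)
    nonParallel-noFarther-point Bl Bm l∦m p∉m walk = 3 , walk-to-point-off≥3 p∉m walk , walk₃ Bl Bm l∦m _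

    nonParallel-noFarther-line : ∀ {l k} → InB l → InB k → ¬ Par k l →
      ∀ {m} → k ≢ m → NoFarther l m (inj₂ k)
    nonParallel-noFarther-line Bl Bk k∦l k≢m walk = 2 , walk-to-other-line≥2 k≢m walk , walk₂ Bl Bk k∦l

    minRep-least : ∀ {l m} → minRep m ≡ true → Par l m → toℕ m ≤ toℕ l
    minRep-least {l} {m} rep l∥m = ≮⇒≥ λ l<m →
      not-true⁻ rep (anyF-intro nl _ l (∧-intro (does-true (toℕ l <? toℕ m) l<m) l∥m))

    -- Skew lines and uncovered directions

    module _ {PS : Fin np → Bool} {LS : Fin nl → Bool} where

      skew : Fin nl → Bool
      skew l = inB l ∧ not (anyF np (λ p → PS p ∧ inc p l))

      skewOutside : Fin nl → Bool
      skewOutside l = skew l ∧ not (LS l)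

      covered : Fin nl → Bool
      covered l = anyF nl (λ m → LS m ∧ par m l)

      uncoveredRep : Fin nl → Bool
      uncoveredRep l = inB l ∧ minRep l ∧ not (covered l)

      directionRep : Fin nl → Bool
      directionRep l = (skewOutside l ∧ covered l) ∨ uncoveredRep l

      skewOutside-InB : ∀ {l} → skewOutside l ≡ true → InB l
      skewOutside-InB t = ∧-conicalˡ _ _ (∧-conicalˡ _ _ t)

      skewOutside-offLine : ∀ {m} → skewOutside m ≡ true → ∀ x → InS PS LS x → OffLine m x
      skewOutside-offLine {m} t (inj₁ p) Sp pm =
        not-true⁻ (∧-conicalʳ (inB m) _ (∧-conicalˡ (skew m) _ t))
          (anyF-intro np (λ r → PS r ∧ inc r m) p (∧-intro Sp pm))
      skewOutside-offLine t (inj₂ k) Sk refl = not-true⁻ (∧-conicalʳ _ _ t) Sk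

      uncovered⇒¬par : ∀ {l} → not (covered l) ≡ true → ∀ k → LS k ≡ true → ¬ Par k l
      uncovered⇒¬par nc k Sk k∥l = not-true⁻ nc (anyF-intro nl _ k (∧-intro Sk k∥l))

      covered-∦-uncovered : ∀ {l m} → covered l ≡ true → not (covered m) ≡ true → ¬ Par l m
      covered-∦-uncovered {l} cl ncm l∥m with anyF-witness nl (λ k → LS k ∧ par k l) cl
      ... | k , Sk∧k∥l = uncovered⇒¬par ncm k (∧-conicalˡ _ _ Sk∧k∥l) (par-trans (∧-conicalʳ _ _ Sk∧k∥l) l∥m)

      uncoveredRep-parallel⇒≡ : ∀ {l m} → uncoveredRep l ≡ true → uncoveredRep m ≡ true → Par l m → l ≡ m
      uncoveredRep-parallel⇒≡ {l} {m} ul um l∥m = toℕ-injective (≤-antisym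
        (minRep-least (rep l ul) (par-sym l∥m)) (minRep-least (rep m um) l∥m))
        where
        rep : ∀ k → uncoveredRep k ≡ true → minRep k ≡ true
        rep k u = ∧-conicalˡ _ _ (∧-conicalʳ (inB k) _ u)

      uncoveredRep-uncovered : ∀ {l} → uncoveredRep l ≡ true → not (covered l) ≡ true
      uncoveredRep-uncovered {l} u = ∧-conicalʳ (minRep l) _ (∧-conicalʳ (inB l) _ u)

      skewCount≤card+skewOutside : skewCount PS ≤ card LS + countF nl skewOutside
      skewCount≤card+skewOutside = begin
        countF nl skew                                          ≡⟨ countF-split nl skew LS ⟩
        countF nl (λ l → skew l ∧ LS l) + countF nl skewOutside ≤⟨ +-monoˡ-≤ _ (countF-mono nl (λ l → ∧-conicalʳ (skew l) _)) ⟩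
        card LS + countF nl skewOutside                         ∎
        where open ≤-Reasoning

      module _ (resolving : Resolving PS LS) where

        resolving⇒¬equidistant : ∀ {l m} → InB l → InB m → l ≢ m →
          (∀ x → InS PS LS x → NoFarther l m x) → (∀ x → InS PS LS x → NoFarther m l x) → ⊥
        resolving⇒¬equidistant {l} {m} Bl Bm l≢m l≼m m≼l
          with proj₂ resolving (inj₂ l) (inj₂ m) Bl Bm (λ { refl → l≢m refl })
        ... | x , x∈S , a , b , (walkᵃ , minᵃ) , (walkᵇ , minᵇ) , a≢b =
          a≢b (≤-antisym (via (l≼m x x∈S) walkᵇ minᵃ) (via (m≼l x x∈S) walkᵃ minᵇ))
          where
          via : ∀ {u v a b} → NoFarther u v x → Walk (inj₂ v) x b →
                (∀ n → Walk (inj₂ u) x n → a ≤ n) → a ≤ b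
          via u≼v walk minimal = let (c , c≤b , walk′) = u≼v walk in ≤-trans (minimal c walk′) c≤b

        skewOutside-parallel⇒≡ : ∀ {l m} → skewOutside l ≡ true → skewOutside m ≡ true → Par l m → l ≡ m
        skewOutside-parallel⇒≡ {l} {m} tl tm l∥m = decidable-stable (l ≟ᶠ m) λ l≢m →
          resolving⇒¬equidistant (skewOutside-InB tl) (skewOutside-InB tm) l≢m
              (λ x x∈S → parallel-noFarther l∥m (skewOutside-InB tl) (skewOutside-offLine tm x x∈S))
              (λ x x∈S → parallel-noFarther (par-sym l∥m) (skewOutside-InB tm) (skewOutside-offLine tl x x∈S))

        nonParallel-uncovered-noFarther : ∀ {l m} → skewOutside l ≡ true → skewOutside m ≡ true →
          not (covered l) ≡ true → not (covered m) ≡ true → ¬ Par l m →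
          ∀ x → InS PS LS x → NoFarther l m x
        nonParallel-uncovered-noFarther tl tm ncl ncm l∦m (inj₁ p) Sp =
          nonParallel-noFarther-point (skewOutside-InB tl) (skewOutside-InB tm) l∦m (skewOutside-offLine tm (inj₁ p) Sp)
        nonParallel-uncovered-noFarther tl tm ncl ncm l∦m (inj₂ k) Sk =
          nonParallel-noFarther-line (skewOutside-InB tl) (proj₁ resolving k Sk) (uncovered⇒¬par ncl k Sk)
            (λ { refl → uncovered⇒¬par ncm k Sk par-refl })

        skewOutside-uncovered-unique : ∀ {l m} → skewOutside l ≡ true → skewOutside m ≡ true →
          not (covered l) ≡ true → not (covered m) ≡ true → l ≡ m
        skewOutside-uncovered-unique {l} {m} tl tm ncl ncm with par? l m
        ... | inj₁ l∥m = skewOutside-parallel⇒≡ tl tm l∥m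
        ... | inj₂ l∦m = decidable-stable (l ≟ᶠ m) λ l≢m →
          resolving⇒¬equidistant (skewOutside-InB tl) (skewOutside-InB tm) l≢m
            (nonParallel-uncovered-noFarther tl tm ncl ncm l∦m) (nonParallel-uncovered-noFarther tm tl ncm ncl (λ m∥l → l∦m (par-sym m∥l)))

        directionRep-InB : ∀ {l} → directionRep l ≡ true → InB l
        directionRep-InB {l} d with ∨-true⁻ (skewOutside l ∧ covered l) _ d
        ... | inj₁ tc = skewOutside-InB (∧-conicalˡ _ _ tc)
        ... | inj₂ u  = ∧-conicalˡ _ _ u

        directionRep-parallel⇒≡ : ∀ {l m} → directionRep l ≡ true → directionRep m ≡ true → Par l m → l ≡ m
        directionRep-parallel⇒≡ {l} {m} dl dm l∥m
          with ∨-true⁻ (skewOutside l ∧ covered l) _ dl | ∨-true⁻ (skewOutside m ∧ covered m) _ dm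
        ... | inj₁ tcl | inj₁ tcm = skewOutside-parallel⇒≡ (∧-conicalˡ _ _ tcl) (∧-conicalˡ _ _ tcm) l∥m
        ... | inj₂ ul  | inj₂ um  = uncoveredRep-parallel⇒≡ ul um l∥m
        ... | inj₁ tcl | inj₂ um  = ⊥-elim (covered-∦-uncovered (∧-conicalʳ _ _ tcl) (uncoveredRep-uncovered um) l∥m)
        ... | inj₂ ul  | inj₁ tcm = ⊥-elim (covered-∦-uncovered (∧-conicalʳ _ _ tcm) (uncoveredRep-uncovered ul) (par-sym l∥m))

        skewOutside-count≤order : countF nl skewOutside ≤ q
        skewOutside-count≤order =
          nonParallel-count≤order l₀ skewOutside (λ _ → skewOutside-InB) (λ _ _ → skewOutside-parallel⇒≡)

        coveredSkewOutside+uncovered≤order :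
          countF nl (λ l → skewOutside l ∧ covered l) + countF nl uncoveredRep ≤ q
        coveredSkewOutside+uncovered≤order = begin
          countF nl (λ l → skewOutside l ∧ covered l) + countF nl uncoveredRep
            ≡⟨ +-comm _ (countF nl uncoveredRep) ⟩
          countF nl uncoveredRep + countF nl (λ l → skewOutside l ∧ covered l)
            ≤⟨ +-mono-≤ (countF-mono nl λ l u → ∧-intro (∨-introʳ (skewOutside l ∧ covered l) u) u)
                        (countF-mono nl λ l tc → ∧-intro (∨-introˡ _ tc)
                           (not-true λ u → not-true⁻ (uncoveredRep-uncovered u) (∧-conicalʳ _ _ tc))) ⟩
          countF nl (λ l → directionRep l ∧ uncoveredRep l) + countF nl (λ l → directionRep l ∧ not (uncoveredRep l))
            ≡⟨ countF-split nl directionRep uncoveredRep ⟨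
          countF nl directionRep
            ≤⟨ nonParallel-count≤order l₀ directionRep (λ _ → directionRep-InB) (λ _ _ → directionRep-parallel⇒≡) ⟩
          q ∎
          where open ≤-Reasoning

        skewOutside+uncovered≤1+order : countF nl skewOutside + countF nl uncoveredRep ≤ 1 + q
        skewOutside+uncovered≤1+order = begin
          countF nl skewOutside + countF nl uncoveredRep
            ≡⟨ cong (_+ countF nl uncoveredRep) (countF-split nl skewOutside covered) ⟩
          (coveredCount + uncoveredCount) + countF nl uncoveredRep
            ≡⟨ cong (_+ countF nl uncoveredRep) (+-comm coveredCount uncoveredCount) ⟩
          (uncoveredCount + coveredCount) + countF nl uncoveredRep
            ≡⟨ +-assoc uncoveredCount coveredCount _ ⟩
          uncoveredCount + (coveredCount + countF nl uncoveredRep)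
            ≤⟨ +-mono-≤ (countF-≤1 nl _ λ l m tl tm →
                           skewOutside-uncovered-unique (∧-conicalˡ _ _ tl) (∧-conicalˡ _ _ tm)
                                                        (∧-conicalʳ _ _ tl) (∧-conicalʳ _ _ tm))
                        coveredSkewOutside+uncovered≤order ⟩
          1 + q ∎
          where
          open ≤-Reasoning
          coveredCount : ℕ
          coveredCount = countF nl (λ l → skewOutside l ∧ covered l)
          uncoveredCount : ℕ
          uncoveredCount = countF nl (λ l → skewOutside l ∧ not (covered l))

mainTheorem14 : (np nl q : ℕ) (inc : Fin np → Fin nl → Bool) →
    Incidence.IsAffinePlane inc q →
    (l₀ : Fin nl) (PS : Fin np → Bool) (LS : Fin nl → Bool) →
    Incidence.Biaffine.Resolving inc l₀ PS LS →
    (Incidence.Biaffine.skewCount inc l₀ PS ≤ Incidence.Biaffine.card inc l₀ LS + q)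
    × (Incidence.Biaffine.skewCount inc l₀ PS + Incidence.Biaffine.uncovered inc l₀ LS
    ≤ Incidence.Biaffine.card inc l₀ LS + q + 1)
mainTheorem14 np nl q inc plane l₀ PS LS resolving =
  ≤-trans skew≤ (+-monoʳ-≤ (card LS) (skewOutside-count≤order l₀ resolving)) ,
  (begin
    skewCount PS + uncovered LS                               ≤⟨ +-monoˡ-≤ (uncovered LS) skew≤ ⟩
    card LS + countF nl (skewOutside l₀) + uncovered LS       ≡⟨ +-assoc (card LS) _ _ ⟩
    card LS + (countF nl (skewOutside l₀) + uncovered LS)     ≤⟨ +-monoʳ-≤ (card LS) (skewOutside+uncovered≤1+order l₀ resolving) ⟩
    card LS + (1 + q)                                         ≡⟨ cong (card LS +_) (+-comm 1 q) ⟩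
    card LS + (q + 1)                                         ≡⟨ +-assoc (card LS) q 1 ⟨
    card LS + q + 1                                           ∎)
  where
  open Incidence inc
  open Biaffine l₀
  open AffinePlane plane
  open ≤-Reasoning
  skew≤ : skewCount PS ≤ card LS + countF nl (skewOutside l₀)
  skew≤ = skewCount≤card+skewOutside l₀
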